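{- Let $A$ be a set partition of $\{1,\dots,n\}$. Then \[ \sum_{v=1}^n \mathtt{t}_v(A)=\mathtt{t}(A), \] where $\mathtt{t}_v(A)$ is the partial depth index of $v$ and $\mathtt{t}(A)$ is the depth index of $A$.
   Context: Arcs of $A$: pairs $(i,j)$, $i<j$, of elements in the same block with no element of that block strictly between them. Let $m$ be the number of arcs. Partner of $v$: the partner $u$ of $v\in\{1,\dots,n\}$ is $0$ if $v$ is the minimum of its block. Otherwise it is the largest element of the block of $v$ smaller than $v$, so that $(u,v)$ is an arc. Partial depth index: $\mathtt{t}_v(A)=u+\#\{\text{arcs }(i,j)\text{ of }A: u<i<j<v\}$, where $u$ is the partner of $v$. Depth index: $\mathrm{depth}(v)$ is the number of arcs $(i,j)$ with $i<v<j$, and for an arc $\alpha=(u,v)$, $\mathrm{depth}(\alpha)$ is the number of arcs $(i,j)$ with $i<u<v<j$. Then \[ \mathtt{t}(A)=\sum_{i=1}^{m}(n-i)-\sum_{v=1}^n\mathrm{depth}(v)+\sum_{\alpha\text{ arc}}\mathrm{depth}(\alpha). \] -}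

module Defs where

open import Data.Nat using (ℕ; zero; suc; _+_; _∸_; _<_; _<?_; _≟_)
open import Data.List using (List; []; _∷_; map; upTo; filter; length; concatMap)
open import Data.Nat.ListAction using (sum)
open import Data.Product using (_×_; _,_; proj₁; proj₂)
open import Data.Integer as ℤ using (ℤ; +_)
open import Data.List.Relation.Unary.All using (All; all?)
open import Relation.Binary.PropositionalEquality using (_≡_)
open import Relation.Nullary using (¬_; Dec; yes; no)
open import Relation.Nullary.Decidable using (_×-dec_; ¬?)

-- A set partition A of {1,…,n} is represented by a block-labelling
-- lab : ℕ → ℕ : elements i, j ∈ {1,…,n} lie in the same block of A iff
-- lab i ≡ lab j.  (Values of lab outside {1,…,n} are irrelevant.)
-- Every labelling induces a set partition and every set partition arises.
Labelling : Set
Labelling = ℕ → ℕ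

range1 : ℕ → List ℕ
range1 n = map suc (upTo n)

between : ℕ → ℕ → List ℕ
between i j = map (λ k → suc (i + k)) (upTo (j ∸ suc i))

IsArc : Labelling → ℕ × ℕ → Set
IsArc lab (i , j) = (i < j) × (lab i ≡ lab j) × All (λ k → ¬ (lab k ≡ lab i)) (between i j)

isArc? : (lab : Labelling) → (p : ℕ × ℕ) → Dec (IsArc lab p)
isArc? lab (i , j) =
  (i <? j) ×-dec ((lab i ≟ lab j) ×-dec all? (λ k → ¬? (lab k ≟ lab i)) (between i j))

pairs : ℕ → List (ℕ × ℕ)
pairs n = concatMap (λ i → map (λ j → (i , j)) (range1 n)) (range1 n)

arcs : ℕ → Labelling → List (ℕ × ℕ)
arcs n lab = filter (isArc? lab) (pairs n)

numArcs : ℕ → Labelling → ℕ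
numArcs n lab = length (arcs n lab)

-- partner of v: the largest element u < v of the block of v, or 0 if none
partnerSearch : Labelling → ℕ → ℕ → ℕ
partnerSearch lab v zero = 0
partnerSearch lab v (suc k) with lab (suc k) ≟ lab v
... | yes _ = suc k
... | no _  = partnerSearch lab v k

partner : Labelling → ℕ → ℕ
partner lab v = partnerSearch lab v (v ∸ 1)

arcsInside : ℕ → Labelling → ℕ → ℕ → ℕ
arcsInside n lab a b =
  length (filter (λ p → (a <? proj₁ p) ×-dec (proj₂ p <? b)) (arcs n lab))

partialDepth : ℕ → Labelling → ℕ → ℕ
partialDepth n lab v = partner lab v + arcsInside n lab (partner lab v) v

depthVertex : ℕ → Labelling → ℕ → ℕ
depthVertex n lab v =
  length (filter (λ p → (proj₁ p <? v) ×-dec (v <? proj₂ p)) (arcs n lab))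

depthArc : ℕ → Labelling → ℕ × ℕ → ℕ
depthArc n lab (u , v) =
  length (filter (λ p → (proj₁ p <? u) ×-dec (v <? proj₂ p)) (arcs n lab))

depthIndex : ℕ → Labelling → ℤ
depthIndex n lab =
  ((+ sum (map (λ i → n ∸ i) (range1 (numArcs n lab))))
    ℤ.- (+ sum (map (depthVertex n lab) (range1 n))))
    ℤ.+ (+ sum (map (depthArc n lab) (arcs n lab)))

sumPartialDepth : ℕ → Labelling → ℕ
sumPartialDepth n lab = sum (map (partialDepth n lab) (range1 n))

module Submission where

-- Proof by induction on n, adding the element n+1 to the ground set.
-- An arc is determined by its right endpoint v: it is the arc (partner v , v).
-- Hence the arcs on {1,…,n+1} are those on {1,…,n} together with the single
-- arc (p , n+1), p the partner of n+1, when p ≠ 0 (lemma arcSum-suc).  Every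
-- statistic entering t(A) counts arcs, so each changes by an explicit amount.
-- Writing m for the number of arcs on {1,…,n} and t for the number of them
-- nested strictly inside (p , n+1), so that t_{n+1}(A) = p + t:
--   Σ_v t_v(A)   grows by p + t            (t_v for v ≤ n is unchanged),
--   Σ_i (n − i)  grows by m,  resp. n      (p = 0, resp. p ≠ 0),
--   Σ depth(v)   grows by 0,  resp. n − p  (the new arc covers p+1,…,n),
--   Σ depth(α)   grows by 0,  resp. t      (the new arc covers those t arcs).
-- In both cases t(A) grows by p + t as well.

open import Defs
open import Data.Nat
open import Data.Nat.Properties
open import Data.Nat.ListAction using (sum)
open import Data.Nat.ListAction.Properties using (sum-++)
open import Algebra.Properties.CommutativeSemigroup +-commutativeSemigroup using (interchange)
open import Data.Bool using (true; false; if_then_else_)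
open import Data.List using (List; []; _∷_; [_]; map; upTo; filter; length; concatMap; _++_)
open import Data.List.Properties using (map-∘; map-cong; map-++; upTo-∷ʳ)
open import Data.List.Relation.Unary.All using (All)
open import Data.List.Relation.Unary.All.Properties using (map⁺; map⁻; applyUpTo⁺₁; applyUpTo⁻)
open import Data.Product using (_×_; _,_; proj₁; proj₂)
open import Data.Sum using (inj₁; inj₂)
open import Relation.Binary.PropositionalEquality using (_≡_; _≢_; refl; sym; trans; cong; cong₂; subst; module ≡-Reasoning)
open import Relation.Nullary using (¬_; Dec; yes; no; does; contradiction)
open import Relation.Nullary.Decidable using (_×-dec_)
open import Relation.Unary using (Pred; Decidable)
open import Level using (0ℓ)
open import Function using (_∘_; id)

when : {P : Set} → Dec P → ℕ → ℕ
when d x = if does d then x else 0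

ind : {P : Set} → Dec P → ℕ
ind d = when d 1

when-yes : {P : Set} (d : Dec P) {x : ℕ} → P → when d x ≡ x
when-yes (yes _) _ = refl
when-yes (no ¬p) p = contradiction p ¬p

when-no : {P : Set} (d : Dec P) {x : ℕ} → ¬ P → when d x ≡ 0
when-no (yes p) ¬p = contradiction p ¬p
when-no (no _)  _  = refl

ind-×-right : {P Q : Set} (d : Dec P) (e : Dec Q) → Q → ind (d ×-dec e) ≡ ind d
ind-×-right (yes _) (yes _) _ = refl
ind-×-right (no _)  (yes _) _ = refl
ind-×-right _       (no ¬q) q = contradiction q ¬q

module _ {A : Set} where

  sum-map-+ : (f g : A → ℕ) (xs : List A) →
              sum (map (λ x → f x + g x) xs) ≡ sum (map f xs) + sum (map g xs)
  sum-map-+ f g []       = refl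
  sum-map-+ f g (x ∷ xs) = begin
    f x + g x + sum (map (λ x → f x + g x) xs)    ≡⟨ cong ((f x + g x) +_) (sum-map-+ f g xs) ⟩
    f x + g x + (sum (map f xs) + sum (map g xs)) ≡⟨ interchange (f x) (g x) _ _ ⟩
    f x + sum (map f xs) + (g x + sum (map g xs)) ∎
    where open ≡-Reasoning

  sum-map-zero : (xs : List A) → sum (map (λ _ → 0) xs) ≡ 0
  sum-map-zero []       = refl
  sum-map-zero (x ∷ xs) = sum-map-zero xs

  length≡sum-ones : (xs : List A) → length xs ≡ sum (map (λ _ → 1) xs)
  length≡sum-ones []       = refl
  length≡sum-ones (x ∷ xs) = cong suc (length≡sum-ones xs)

  sum-filter : {P : Pred A 0ℓ} (P? : Decidable P) (f : A → ℕ) (xs : List A) →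
               sum (map f (filter P? xs)) ≡ sum (map (λ x → when (P? x) (f x)) xs)
  sum-filter P? f []       = refl
  sum-filter P? f (x ∷ xs) with does (P? x)
  ... | true  = cong (f x +_) (sum-filter P? f xs)
  ... | false = sum-filter P? f xs

module _ {A B : Set} where

  sum-concatMap : (f : B → ℕ) (g : A → List B) (xs : List A) →
                  sum (map f (concatMap g xs)) ≡ sum (map (λ x → sum (map f (g x))) xs)
  sum-concatMap f g []       = refl
  sum-concatMap f g (x ∷ xs) = begin
    sum (map f (g x ++ concatMap g xs))
      ≡⟨ cong sum (map-++ f (g x) (concatMap g xs)) ⟩
    sum (map f (g x) ++ map f (concatMap g xs))
      ≡⟨ sum-++ (map f (g x)) _ ⟩
    sum (map f (g x)) + sum (map f (concatMap g xs))
      ≡⟨ cong (sum (map f (g x)) +_) (sum-concatMap f g xs) ⟩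
    sum (map f (g x)) + sum (map (λ x → sum (map f (g x))) xs) ∎
    where open ≡-Reasoning

rangeSum : ℕ → (ℕ → ℕ) → ℕ
rangeSum n f = sum (map f (range1 n))

rangeSum-suc : ∀ n f → rangeSum (suc n) f ≡ rangeSum n f + f (suc n)
rangeSum-suc n f = begin
  sum (map f (map suc (upTo (suc n))))
    ≡⟨ cong (λ xs → sum (map f (map suc xs))) (upTo-∷ʳ n) ⟨
  sum (map f (map suc (upTo n ++ [ n ])))
    ≡⟨ cong (λ xs → sum (map f xs)) (map-++ suc (upTo n) [ n ]) ⟩
  sum (map f (range1 n ++ [ suc n ]))
    ≡⟨ cong sum (map-++ f (range1 n) [ suc n ]) ⟩
  sum (map f (range1 n) ++ [ f (suc n) ])
    ≡⟨ sum-++ (map f (range1 n)) [ f (suc n) ] ⟩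
  rangeSum n f + (f (suc n) + 0)
    ≡⟨ cong (rangeSum n f +_) (+-identityʳ (f (suc n))) ⟩
  rangeSum n f + f (suc n) ∎
  where open ≡-Reasoning

rangeSum-cong : ∀ n {f g : ℕ → ℕ} → (∀ v → 0 < v → v ≤ n → f v ≡ g v) → rangeSum n f ≡ rangeSum n g
rangeSum-cong zero    _ = refl
rangeSum-cong (suc n) {f} {g} f≗g = begin
  rangeSum (suc n) f       ≡⟨ rangeSum-suc n f ⟩
  rangeSum n f + f (suc n) ≡⟨ cong₂ _+_ (rangeSum-cong n (λ v 0<v v≤n → f≗g v 0<v (m≤n⇒m≤1+n v≤n)))
                                        (f≗g (suc n) z<s ≤-refl) ⟩
  rangeSum n g + g (suc n) ≡⟨ rangeSum-suc n g ⟨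
  rangeSum (suc n) g       ∎
  where open ≡-Reasoning

rangeSum-above : ∀ n p → rangeSum n (λ v → ind (p <? v)) ≡ n ∸ p
rangeSum-above zero    p = sym (0∸n≡0 p)
rangeSum-above (suc n) p with p ≤? n
... | yes p≤n = begin
  rangeSum (suc n) (λ v → ind (p <? v)) ≡⟨ rangeSum-suc n _ ⟩
  rangeSum n (λ v → ind (p <? v)) + ind (p <? suc n)
    ≡⟨ cong₂ _+_ (rangeSum-above n p) (when-yes (p <? suc n) (s≤s p≤n)) ⟩
  n ∸ p + 1 ≡⟨ +-comm (n ∸ p) 1 ⟩
  1 + (n ∸ p) ≡⟨ +-∸-assoc 1 p≤n ⟨
  suc n ∸ p ∎
  where open ≡-Reasoning
... | no p≰n = begin
  rangeSum (suc n) (λ v → ind (p <? v)) ≡⟨ rangeSum-suc n _ ⟩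
  rangeSum n (λ v → ind (p <? v)) + ind (p <? suc n)
    ≡⟨ cong₂ _+_ (rangeSum-above n p) (when-no (p <? suc n) (p≰n ∘ s≤s⁻¹)) ⟩
  n ∸ p + 0 ≡⟨ cong (_+ 0) (m≤n⇒m∸n≡0 (≰⇒≥ p≰n)) ⟩
  0 ≡⟨ m≤n⇒m∸n≡0 (≰⇒> p≰n) ⟨
  suc n ∸ p ∎
  where open ≡-Reasoning

rangeSum-∸-suc : ∀ {n k} → k ≤ n → rangeSum k (λ i → suc n ∸ i) ≡ rangeSum k (λ i → n ∸ i) + k
rangeSum-∸-suc {n} {k} k≤n = begin
  rangeSum k (λ i → suc n ∸ i)
    ≡⟨ rangeSum-cong k (λ i _ i≤k → +-∸-assoc 1 (≤-trans i≤k k≤n)) ⟩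
  rangeSum k (λ i → 1 + (n ∸ i))
    ≡⟨ sum-map-+ (λ _ → 1) (λ i → n ∸ i) (range1 k) ⟩
  rangeSum k (λ _ → 1) + rangeSum k (λ i → n ∸ i)
    ≡⟨ cong (_+ rangeSum k (λ i → n ∸ i)) (rangeSum-ones k) ⟩
  k + rangeSum k (λ i → n ∸ i)
    ≡⟨ +-comm k _ ⟩
  rangeSum k (λ i → n ∸ i) + k ∎
  where
  open ≡-Reasoning
  rangeSum-ones : ∀ k → rangeSum k (λ _ → 1) ≡ k
  rangeSum-ones zero    = refl
  rangeSum-ones (suc k) = trans (rangeSum-suc k _) (trans (cong (_+ 1) (rangeSum-ones k)) (+-comm k 1))

all-between⁺ : ∀ {P : ℕ → Set} i j → (∀ w → i < w → w < j → P w) → All P (between i j)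
all-between⁺ {P} i j Pw =
  map⁺ (applyUpTo⁺₁ {P = P ∘ λ k → suc (i + k)} id (j ∸ suc i)
         (λ {k} k< → Pw (suc (i + k)) (s≤s (m≤m+n i k)) (shifted-< i j k k<)))
  where
  shifted-< : ∀ i j k → k < j ∸ suc i → suc (i + k) < j
  shifted-< zero    (suc j) k k< = s≤s k<
  shifted-< (suc i) (suc j) k k< = s≤s (shifted-< i j k k<)

all-between⁻ : ∀ {P : ℕ → Set} {i j w} → All P (between i j) → i < w → w < j → P w
all-between⁻ {P} {i} {j} {w} all i<w w<j =
  subst P (m+[n∸m]≡n i<w)
    (applyUpTo⁻ {P = P ∘ λ k → suc (i + k)} id (j ∸ suc i) (map⁻ all) (∸-monoˡ-< w<j i<w))

-- the contribution f (p , v) of the arc (p , v) ending at v, where p is the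
-- partner of v; partner 0 means that no arc ends at v
arcAt : ℕ → ℕ → (ℕ × ℕ → ℕ) → ℕ
arcAt zero    v f = 0
arcAt (suc p) v f = f (suc p , v)

arcAt-cong : ∀ p v {f g : ℕ × ℕ → ℕ} → (∀ i → 0 < i → f (i , v) ≡ g (i , v)) → arcAt p v f ≡ arcAt p v g
arcAt-cong zero    v _   = refl
arcAt-cong (suc p) v f≗g = f≗g (suc p) z<s

arcAt-vanishes : ∀ p v {f : ℕ × ℕ → ℕ} → (∀ i → f (i , v) ≡ 0) → arcAt p v f ≡ 0
arcAt-vanishes zero    v _  = refl
arcAt-vanishes (suc p) v f0 = f0 (suc p)

module _ (lab : Labelling) where

  arcSum : ℕ → (ℕ × ℕ → ℕ) → ℕ
  arcSum n f = sum (map f (arcs n lab))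

  onArc : (ℕ × ℕ → ℕ) → ℕ × ℕ → ℕ
  onArc f α = when (isArc? lab α) (f α)

  arcSum-double : ∀ n f → arcSum n f ≡ rangeSum n (λ i → rangeSum n (λ j → onArc f (i , j)))
  arcSum-double n f = begin
    sum (map f (filter (isArc? lab) (pairs n)))
      ≡⟨ sum-filter (isArc? lab) f (pairs n) ⟩
    sum (map (onArc f) (concatMap (λ i → map (i ,_) (range1 n)) (range1 n)))
      ≡⟨ sum-concatMap (onArc f) (λ i → map (i ,_) (range1 n)) (range1 n) ⟩
    sum (map (λ i → sum (map (onArc f) (map (i ,_) (range1 n)))) (range1 n))
      ≡⟨ cong sum (map-cong (λ i → cong sum (map-∘ (range1 n))) (range1 n)) ⟨
    rangeSum n (λ i → rangeSum n (λ j → onArc f (i , j))) ∎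
    where open ≡-Reasoning

  -- among the pairs (i , v) with i ≤ k < v, the only possible arc is the one
  -- starting at the last element of v's block in 1,…,k, provided no element
  -- of that block lies in k+1,…,v-1
  arcsInto : ∀ f v k → k < v → (∀ w → k < w → w < v → lab w ≢ lab v) →
             rangeSum k (λ i → onArc f (i , v)) ≡ arcAt (partnerSearch lab v k) v f
  arcsInto f v zero    _   _   = refl
  arcsInto f v (suc k) k<v gap with lab (suc k) ≟ lab v
  ... | yes same = trans (rangeSum-suc k _) (cong₂ _+_ noEarlierArc (when-yes (isArc? lab _) isArc))
    where
    isArc : IsArc lab (suc k , v)
    isArc = k<v , same , all-between⁺ (suc k) v (λ w k<w w<v eq → gap w k<w w<v (trans eq same))
    noEarlierArc : rangeSum k (λ i → onArc f (i , v)) ≡ 0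
    noEarlierArc = trans
      (rangeSum-cong k (λ i _ i≤k → when-no (isArc? lab _)
         (λ { (_ , same′ , gap′) → all-between⁻ gap′ (s≤s i≤k) k<v (trans same (sym same′)) })))
      (sum-map-zero (range1 k))
  ... | no differ = trans (rangeSum-suc k _)
      (trans (cong₂ _+_ (arcsInto f v k (<-trans (n<1+n k) k<v) gap′)
                        (when-no (isArc? lab _) (λ { (_ , same , _) → differ same })))
             (+-identityʳ _))
    where
    gap′ : ∀ w → k < w → w < v → lab w ≢ lab v
    gap′ w k<w w<v with m≤n⇒m<n∨m≡n k<w
    ... | inj₁ k+1<w = gap w k+1<w w<v
    ... | inj₂ refl  = differ

  arcSum-suc : ∀ n f → arcSum (suc n) f ≡ arcSum n f + arcAt (partner lab (suc n)) (suc n) f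
  arcSum-suc n f = begin
    arcSum (suc n) f
      ≡⟨ arcSum-double (suc n) f ⟩
    rangeSum (suc n) (λ i → rangeSum (suc n) (λ j → g i j))
      ≡⟨ rangeSum-suc n _ ⟩
    rangeSum n (λ i → rangeSum (suc n) (λ j → g i j)) + rangeSum (suc n) (λ j → g (suc n) j)
      ≡⟨ cong₂ _+_ (rangeSum-cong n (λ i _ _ → rangeSum-suc n _)) noArcFromTop ⟩
    rangeSum n (λ i → rangeSum n (λ j → g i j) + g i (suc n)) + 0
      ≡⟨ +-identityʳ _ ⟩
    rangeSum n (λ i → rangeSum n (λ j → g i j) + g i (suc n))
      ≡⟨ sum-map-+ (λ i → rangeSum n (λ j → g i j)) (λ i → g i (suc n)) (range1 n) ⟩
    rangeSum n (λ i → rangeSum n (λ j → g i j)) + rangeSum n (λ i → g i (suc n))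
      ≡⟨ cong₂ _+_ (sym (arcSum-double n f)) (arcsInto f (suc n) n ≤-refl nothingBetween) ⟩
    arcSum n f + arcAt (partner lab (suc n)) (suc n) f ∎
    where
    open ≡-Reasoning
    g : ℕ → ℕ → ℕ
    g i j = onArc f (i , j)
    noArcFromTop : rangeSum (suc n) (λ j → g (suc n) j) ≡ 0
    noArcFromTop = trans
      (rangeSum-cong (suc n) (λ j _ j≤n+1 → when-no (isArc? lab _) (λ { (n+1<j , _) → ≤⇒≯ j≤n+1 n+1<j })))
      (sum-map-zero (range1 (suc n)))
    nothingBetween : ∀ w → n < w → w < suc n → lab w ≢ lab (suc n)
    nothingBetween w n<w w<n+1 = contradiction n<w (≤⇒≯ (s≤s⁻¹ w<n+1))

  arcSum-cong : ∀ n {f g : ℕ × ℕ → ℕ} →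
                (∀ i j → 0 < i → j ≤ n → f (i , j) ≡ g (i , j)) → arcSum n f ≡ arcSum n g
  arcSum-cong zero    _   = refl
  arcSum-cong (suc n) {f} {g} f≗g = begin
    arcSum (suc n) f                                   ≡⟨ arcSum-suc n f ⟩
    arcSum n f + arcAt (partner lab (suc n)) (suc n) f
      ≡⟨ cong₂ _+_ (arcSum-cong n (λ i j 0<i j≤n → f≗g i j 0<i (m≤n⇒m≤1+n j≤n)))
                   (arcAt-cong (partner lab (suc n)) (suc n) (λ i 0<i → f≗g i (suc n) 0<i ≤-refl)) ⟩
    arcSum n g + arcAt (partner lab (suc n)) (suc n) g ≡⟨ arcSum-suc n g ⟨
    arcSum (suc n) g                                   ∎
    where open ≡-Reasoning

  count-arcs : ∀ n {P : Pred (ℕ × ℕ) 0ℓ} (P? : Decidable P) →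
               length (filter P? (arcs n lab)) ≡ arcSum n (λ α → ind (P? α))
  count-arcs n P? = trans (length≡sum-ones (filter P? (arcs n lab))) (sum-filter P? (λ _ → 1) (arcs n lab))

  count-suc : ∀ n {P : Pred (ℕ × ℕ) 0ℓ} (P? : Decidable P) →
              length (filter P? (arcs (suc n) lab))
                ≡ length (filter P? (arcs n lab)) + arcAt (partner lab (suc n)) (suc n) (λ α → ind (P? α))
  count-suc n P? = trans (count-arcs (suc n) P?)
    (trans (arcSum-suc n _) (cong (_+ arcAt (partner lab (suc n)) (suc n) _) (sym (count-arcs n P?))))

  count-none : ∀ n {P : Pred (ℕ × ℕ) 0ℓ} (P? : Decidable P) →
               (∀ i j → 0 < i → j ≤ n → ¬ P (i , j)) → length (filter P? (arcs n lab)) ≡ 0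
  count-none n P? never = trans (count-arcs n P?)
    (trans (arcSum-cong n (λ i j 0<i j≤n → when-no (P? _) (never i j 0<i j≤n))) (sum-map-zero (arcs n lab)))

  count-all : ∀ n {P : Pred (ℕ × ℕ) 0ℓ} (P? : Decidable P) →
              (∀ i j → 0 < i → j ≤ n → P (i , j)) → length (filter P? (arcs n lab)) ≡ numArcs n lab
  count-all n P? always = trans (count-arcs n P?)
    (trans (arcSum-cong n (λ i j 0<i j≤n → when-yes (P? _) (always i j 0<i j≤n))) (sym (length≡sum-ones (arcs n lab))))

  numArcs-suc : ∀ n → numArcs (suc n) lab ≡ arcAt (partner lab (suc n)) (suc n) (λ _ → 1) + numArcs n lab
  numArcs-suc n = begin
    numArcs (suc n) lab  ≡⟨ length≡sum-ones (arcs (suc n) lab) ⟩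
    arcSum (suc n) (λ _ → 1) ≡⟨ arcSum-suc n _ ⟩
    arcSum n (λ _ → 1) + new ≡⟨ +-comm _ new ⟩
    new + arcSum n (λ _ → 1) ≡⟨ cong (new +_) (length≡sum-ones (arcs n lab)) ⟨
    new + numArcs n lab ∎
    where
    open ≡-Reasoning
    new : ℕ
    new = arcAt (partner lab (suc n)) (suc n) (λ _ → 1)

  numArcs-≤ : ∀ n → numArcs n lab ≤ n
  numArcs-≤ zero    = z≤n
  numArcs-≤ (suc n) = subst (_≤ suc n) (sym (numArcs-suc n))
    (+-mono-≤ (atMostOne (partner lab (suc n))) (numArcs-≤ n))
    where
    atMostOne : ∀ p → arcAt p (suc n) (λ _ → 1) ≤ 1
    atMostOne zero    = z≤n
    atMostOne (suc p) = ≤-refl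

  partnerSearch-≤ : ∀ v k → partnerSearch lab v k ≤ k
  partnerSearch-≤ v zero = z≤n
  partnerSearch-≤ v (suc k) with lab (suc k) ≟ lab v
  ... | yes _ = ≤-refl
  ... | no  _ = m≤n⇒m≤1+n (partnerSearch-≤ v k)

arcIndexSum : ℕ → Labelling → ℕ
arcIndexSum n lab = rangeSum (numArcs n lab) (λ i → n ∸ i)

vertexDepthSum : ℕ → Labelling → ℕ
vertexDepthSum n lab = rangeSum n (depthVertex n lab)

arcDepthSum : ℕ → Labelling → ℕ
arcDepthSum n lab = arcSum lab n (depthArc n lab)

arcIndexSum-step : ∀ {n m} q v → m ≤ n →
  rangeSum (arcAt q v (λ _ → 1) + m) (λ i → suc n ∸ i)
    ≡ rangeSum m (λ i → n ∸ i) + (m + arcAt q v (λ _ → n ∸ m))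
arcIndexSum-step {n} {m} zero v m≤n =
  trans (rangeSum-∸-suc m≤n) (cong (rangeSum m (λ i → n ∸ i) +_) (sym (+-identityʳ m)))
arcIndexSum-step {n} {m} (suc q) v m≤n = begin
  rangeSum (suc m) (λ i → suc n ∸ i)     ≡⟨ rangeSum-suc m _ ⟩
  rangeSum m (λ i → suc n ∸ i) + (n ∸ m) ≡⟨ cong (_+ (n ∸ m)) (rangeSum-∸-suc m≤n) ⟩
  rangeSum m (λ i → n ∸ i) + m + (n ∸ m) ≡⟨ +-assoc (rangeSum m (λ i → n ∸ i)) m (n ∸ m) ⟩
  rangeSum m (λ i → n ∸ i) + (m + (n ∸ m)) ∎
  where open ≡-Reasoning

-- the gains balance: gain of Σ(n ∸ i) + gain of Σ depth(α) = gain of Σ depth(v) + (q + t),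
-- where q is the partner of the new element and t the number of arcs nested under it
increments-balance : ∀ {n m t} q v → q ≤ n → m ≤ n → (q ≡ 0 → t ≡ m) →
  (m + arcAt q v (λ _ → n ∸ m)) + arcAt q v (λ _ → t) ≡ arcAt q v (λ _ → n ∸ q) + (q + t)
increments-balance {m = m} zero v _ _ t≡m = trans (+-identityʳ _) (trans (+-identityʳ m) (sym (t≡m refl)))
increments-balance {n} {m} {t} (suc q) v q<n m≤n _ = begin
  m + (n ∸ m) + t       ≡⟨ cong (_+ t) (m+[n∸m]≡n m≤n) ⟩
  n + t                 ≡⟨ cong (_+ t) (m∸n+n≡m q<n) ⟨
  n ∸ suc q + suc q + t ≡⟨ +-assoc (n ∸ suc q) (suc q) t ⟩
  n ∸ suc q + (suc q + t) ∎
  where open ≡-Reasoning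

module Increments (lab : Labelling) (n : ℕ) where

  p : ℕ
  p = partner lab (suc n)

  nested : ℕ
  nested = arcsInside n lab p (suc n)

  nested-unpartnered : p ≡ 0 → nested ≡ numArcs n lab
  nested-unpartnered p≡0 = trans (cong (λ q → arcsInside n lab q (suc n)) p≡0)
    (count-all lab n (λ α → (0 <? proj₁ α) ×-dec (proj₂ α <? suc n)) (λ i j 0<i j≤n → 0<i , s≤s j≤n))

  -- no arc ending at n+1 lies strictly before v ≤ n+1, so t_v is unchanged
  arcsInside-suc : ∀ a v → v ≤ suc n → arcsInside (suc n) lab a v ≡ arcsInside n lab a v
  arcsInside-suc a v v≤n+1 = trans (count-suc lab n _)
    (trans (cong (arcsInside n lab a v +_)
             (arcAt-vanishes p (suc n) (λ i → when-no ((a <? i) ×-dec (suc n <? v)) (λ { (_ , n+1<v) → ≤⇒≯ v≤n+1 n+1<v }))))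
           (+-identityʳ _))

  sumPartialDepth-suc : sumPartialDepth (suc n) lab ≡ sumPartialDepth n lab + (p + nested)
  sumPartialDepth-suc = begin
    rangeSum (suc n) (partialDepth (suc n) lab)
      ≡⟨ rangeSum-cong (suc n) (λ v _ v≤n+1 → cong (partner lab v +_) (arcsInside-suc (partner lab v) v v≤n+1)) ⟩
    rangeSum (suc n) (partialDepth n lab)
      ≡⟨ rangeSum-suc n _ ⟩
    sumPartialDepth n lab + (p + nested) ∎
    where open ≡-Reasoning

  arcIndexGain vertexDepthGain arcDepthGain : ℕ
  arcIndexGain    = numArcs n lab + arcAt p (suc n) (λ _ → n ∸ numArcs n lab)
  vertexDepthGain = arcAt p (suc n) (λ _ → n ∸ p)
  arcDepthGain    = arcAt p (suc n) (λ _ → nested)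

  arcIndexSum-suc : arcIndexSum (suc n) lab ≡ arcIndexSum n lab + arcIndexGain
  arcIndexSum-suc = trans (cong (λ k → rangeSum k (λ i → suc n ∸ i)) (numArcs-suc lab n))
                          (arcIndexSum-step p (suc n) (numArcs-≤ lab n))

  verticesBelow : ∀ q → rangeSum n (λ v → arcAt q (suc n) (λ α → ind ((proj₁ α <? v) ×-dec (v <? proj₂ α))))
                          ≡ arcAt q (suc n) (λ _ → n ∸ q)
  verticesBelow zero    = sum-map-zero (range1 n)
  verticesBelow (suc q) = trans
    (rangeSum-cong n (λ v _ v≤n → ind-×-right (suc q <? v) (v <? suc n) (s≤s v≤n)))
    (rangeSum-above n (suc q))

  vertexDepthSum-suc : vertexDepthSum (suc n) lab ≡ vertexDepthSum n lab + vertexDepthGain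
  vertexDepthSum-suc = begin
    rangeSum (suc n) (depthVertex (suc n) lab)
      ≡⟨ rangeSum-suc n _ ⟩
    rangeSum n (depthVertex (suc n) lab) + depthVertex (suc n) lab (suc n)
      ≡⟨ cong₂ _+_ (cong sum (map-cong (λ v → count-suc lab n _) (range1 n))) topUncovered ⟩
    rangeSum n (λ v → depthVertex n lab v + newDepth v) + 0
      ≡⟨ +-identityʳ _ ⟩
    rangeSum n (λ v → depthVertex n lab v + newDepth v)
      ≡⟨ sum-map-+ (depthVertex n lab) newDepth (range1 n) ⟩
    vertexDepthSum n lab + rangeSum n newDepth
      ≡⟨ cong (vertexDepthSum n lab +_) (verticesBelow p) ⟩
    vertexDepthSum n lab + arcAt p (suc n) (λ _ → n ∸ p) ∎
    where
    open ≡-Reasoning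
    newDepth : ℕ → ℕ
    newDepth v = arcAt p (suc n) (λ α → ind ((proj₁ α <? v) ×-dec (v <? proj₂ α)))
    topUncovered : depthVertex (suc n) lab (suc n) ≡ 0
    topUncovered = count-none lab (suc n) _ (λ i j _ j≤n+1 → λ { (_ , n+1<j) → ≤⇒≯ j≤n+1 n+1<j })

  arcsBelow : ∀ q → arcSum lab n (λ α → arcAt q (suc n) (λ β → ind ((proj₁ β <? proj₁ α) ×-dec (proj₂ α <? proj₂ β))))
                      ≡ arcAt q (suc n) (λ _ → arcsInside n lab q (suc n))
  arcsBelow zero    = sum-map-zero (arcs n lab)
  arcsBelow (suc q) = sym (count-arcs lab n _)

  arcDepthSum-suc : arcDepthSum (suc n) lab ≡ arcDepthSum n lab + arcDepthGain
  arcDepthSum-suc = begin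
    arcSum lab (suc n) (depthArc (suc n) lab)
      ≡⟨ arcSum-suc lab n _ ⟩
    arcSum lab n (depthArc (suc n) lab) + arcAt p (suc n) (depthArc (suc n) lab)
      ≡⟨ cong₂ _+_ (cong sum (map-cong (λ α → count-suc lab n _) (arcs n lab)))
                   (arcAt-vanishes p (suc n) topArcUncovered) ⟩
    arcSum lab n (λ α → depthArc n lab α + newDepth α) + 0
      ≡⟨ +-identityʳ _ ⟩
    arcSum lab n (λ α → depthArc n lab α + newDepth α)
      ≡⟨ sum-map-+ (depthArc n lab) newDepth (arcs n lab) ⟩
    arcDepthSum n lab + arcSum lab n newDepth
      ≡⟨ cong (arcDepthSum n lab +_) (arcsBelow p) ⟩
    arcDepthSum n lab + arcAt p (suc n) (λ _ → nested) ∎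
    where
    open ≡-Reasoning
    newDepth : ℕ × ℕ → ℕ
    newDepth α = arcAt p (suc n) (λ β → ind ((proj₁ β <? proj₁ α) ×-dec (proj₂ α <? proj₂ β)))
    topArcUncovered : ∀ i → depthArc (suc n) lab (i , suc n) ≡ 0
    topArcUncovered i = count-none lab (suc n) _ (λ _ j _ j≤n+1 → λ { (_ , n+1<j) → ≤⇒≯ j≤n+1 n+1<j })

-- imported only here: the prefix +_ of ℤ would clash with sections (x +_) above
open import Data.Integer as ℤ using (+_)
open import Data.Integer.Properties using (pos-+)
open import Data.Integer.Tactic.RingSolver using (solve-∀)

difference-step : ∀ A B C a b c {A′ B′ C′ d : ℕ} →
  A′ ≡ A + a → B′ ≡ B + b → C′ ≡ C + c → a + c ≡ b + d →
  (+ A′ ℤ.- + B′) ℤ.+ + C′ ≡ ((+ A ℤ.- + B) ℤ.+ + C) ℤ.+ + d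
difference-step A B C a b c {d = d} refl refl refl balance = begin
  (+ (A + a) ℤ.- + (B + b)) ℤ.+ + (C + c)
    ≡⟨ cong₂ ℤ._+_ (cong₂ ℤ._-_ (pos-+ A a) (pos-+ B b)) (pos-+ C c) ⟩
  ((+ A ℤ.+ + a) ℤ.- (+ B ℤ.+ + b)) ℤ.+ (+ C ℤ.+ + c)
    ≡⟨ regroup (+ A) (+ B) (+ C) (+ a) (+ b) (+ c) ⟩
  ((+ A ℤ.- + B) ℤ.+ + C) ℤ.+ ((+ a ℤ.+ + c) ℤ.- + b)
    ≡⟨ cong (λ x → ((+ A ℤ.- + B) ℤ.+ + C) ℤ.+ (x ℤ.- + b))
            (trans (sym (pos-+ a c)) (trans (cong +_ balance) (pos-+ b d))) ⟩
  ((+ A ℤ.- + B) ℤ.+ + C) ℤ.+ ((+ b ℤ.+ + d) ℤ.- + b)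
    ≡⟨ cancel ((+ A ℤ.- + B) ℤ.+ + C) (+ b) (+ d) ⟩
  ((+ A ℤ.- + B) ℤ.+ + C) ℤ.+ + d ∎
  where
  open ≡-Reasoning
  regroup : ∀ A B C a b c → ((A ℤ.+ a) ℤ.- (B ℤ.+ b)) ℤ.+ (C ℤ.+ c) ≡ ((A ℤ.- B) ℤ.+ C) ℤ.+ ((a ℤ.+ c) ℤ.- b)
  regroup = solve-∀
  cancel : ∀ X b d → X ℤ.+ ((b ℤ.+ d) ℤ.- b) ≡ X ℤ.+ d
  cancel = solve-∀

depthIndex-suc : ∀ n lab → depthIndex (suc n) lab ≡ depthIndex n lab ℤ.+ + partialDepth n lab (suc n)
depthIndex-suc n lab =
  difference-step (arcIndexSum n lab) (vertexDepthSum n lab) (arcDepthSum n lab)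
                  arcIndexGain vertexDepthGain arcDepthGain
                  arcIndexSum-suc vertexDepthSum-suc arcDepthSum-suc
    (increments-balance p (suc n) (partnerSearch-≤ lab (suc n) n) (numArcs-≤ lab n) nested-unpartnered)
  where open Increments lab n

mainTheorem2 : (n : ℕ) (lab : Labelling) → + sumPartialDepth n lab ≡ depthIndex n lab
mainTheorem2 zero    lab = refl
mainTheorem2 (suc n) lab = begin
  + sumPartialDepth (suc n) lab
    ≡⟨ cong +_ sumPartialDepth-suc ⟩
  + (sumPartialDepth n lab + partialDepth n lab (suc n))
    ≡⟨ pos-+ (sumPartialDepth n lab) (partialDepth n lab (suc n)) ⟩
  + sumPartialDepth n lab ℤ.+ + partialDepth n lab (suc n)
    ≡⟨ cong (ℤ._+ + partialDepth n lab (suc n)) (mainTheorem2 n lab) ⟩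
  depthIndex n lab ℤ.+ + partialDepth n lab (suc n)
    ≡⟨ depthIndex-suc n lab ⟨
  depthIndex (suc n) lab ∎
  where
  open ≡-Reasoning
  open Increments lab n using (sumPartialDepth-suc)
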